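{- Let $l_1\ge0$, $l_2\ge0$, $l_3\ge3$ be integers and let $\sigma$ be the substitution on $\{0,1\}$ given by $1\mapsto 1\,0^{l_1}\,1\,0^{l_2}$, $0\mapsto 0^{l_3}$. Let $\mathbf{c}=\sigma^\infty(1)$ be its fixed point beginning with $1$, and write $\mathbf{c}=1\,0^{\mu_1}\,1\,0^{\mu_2}\,1\cdots$, i.e. $\mu_n$ is the number of $0$'s between the $n$-th and $(n+1)$-th $1$ of $\mathbf{c}$. Then for all $n\ge1$, writing $n=2^k(2j+1)$ with $k,j\ge0$, \[ \mu_n=\frac{l_2(l_3^k-1)}{l_3-1}+l_1l_3^k . \]
   Context: $0^{l}$ denotes a block of $l$ zeros. -}

module Defs where

open import Data.Bool using (Bool; true; false)
open import Data.Nat using (ℕ; zero; suc; _+_; _*_; _∸_; _^_; _≤_; _<_; z≤n; s≤s; NonZero; _/_; >-nonZero)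
open import Data.Product using (Σ; _×_)
open import Relation.Binary.PropositionalEquality using (_≡_)
open import Data.List using (List; []; _∷_; _++_; concatMap; replicate)
open import Function using (_∘_)

-- Letters: true = 1, false = 0.

zeros : ℕ → List Bool
zeros l = replicate l false

σ : ℕ → ℕ → ℕ → Bool → List Bool
σ l1 l2 l3 true  = true ∷ zeros l1 ++ true ∷ zeros l2
σ l1 l2 l3 false = zeros l3

σ* : ℕ → ℕ → ℕ → List Bool → List Bool
σ* l1 l2 l3 = concatMap (σ l1 l2 l3)

σ^ : ℕ → ℕ → ℕ → ℕ → List Bool
σ^ l1 l2 l3 zero    = true ∷ []
σ^ l1 l2 l3 (suc m) = σ* l1 l2 l3 (σ^ l1 l2 l3 m)

-- i-th letter (0-indexed) of a finite word, default 0 if out of range.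
at : List Bool → ℕ → Bool
at []       _       = false
at (x ∷ xs) zero    = x
at (x ∷ xs) (suc i) = at xs i

-- Since σ(1) begins with 1 and has length ≥ 2, σ^m(1) is a prefix of
-- σ^{m+1}(1) and |σ^m(1)| ≥ 2^m ≥ m+1, so the i-th letter of σ^∞(1)
-- equals the i-th letter of σ^{i+1}(1).
fixpt : ℕ → ℕ → ℕ → ℕ → Bool
fixpt l1 l2 l3 i = at (σ^ l1 l2 l3 (suc i)) i

countOnes : (ℕ → Bool) → ℕ → ℕ
countOnes w zero    = 0
countOnes w (suc p) with w p
... | true  = suc (countOnes w p)
... | false = countOnes w p

IsMu : (ℕ → Bool) → ℕ → ℕ → Set
IsMu w n m = Σ ℕ λ p →
    (w p ≡ true) × (suc (countOnes w p) ≡ n) × (w (p + suc m) ≡ true)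
  × (∀ i → i < m → w (p + suc i) ≡ false)

nz : ∀ {l3} → 3 ≤ l3 → NonZero (l3 ∸ 1)
nz (s≤s (s≤s (s≤s _))) = >-nonZero (s≤s z≤n)

muFormula : (l1 l2 l3 : ℕ) → 3 ≤ l3 → ℕ → ℕ
muFormula l1 l2 l3 h k =
  _/_ (l2 * (l3 ^ k ∸ 1)) (l3 ∸ 1) {{nz h}} + l1 * l3 ^ k

module Submission where

open import Defs
open import Data.Bool using (Bool; true; false)
open import Data.Empty using (⊥-elim)
open import Data.List using (List; []; _∷_; _++_; length)
open import Data.List.Properties using (length-++; length-replicate; ++-assoc; concatMap-++; ++-identityʳ)
open import Data.Nat using (ℕ; zero; suc; _+_; _*_; _^_; _∸_; _/_; _≤_; _<_; _≤′_; ≤′-refl; ≤′-step; z≤n; s≤s)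
open import Data.Nat.DivMod using (m*n/n≡m)
open import Data.Nat.Properties
open import Data.Nat.Tactic.RingSolver using (solve-∀)
open import Data.Product using (Σ; _×_; _,_)
open import Data.Sum using (inj₁; inj₂)
open import Function using (_∘_)
open import Relation.Binary.PropositionalEquality

-- The word σ^m(1) is determined by its list of gaps (runs of 0's after each 1),
-- and σ acts on gap lists by g ↦ l1, l2 + l3 g: every 1 of σ^m(1) produces two
-- 1's of σ^{m+1}(1), the first followed by l1 zeros and the second by l2 zeros
-- plus the l3-fold image of the old gap. Hence the gaps at odd indices n are l1,
-- and μ_{2n} = l2 + l3 μ_n; unfolding this recurrence k times gives the formula.
-- The words σ^m(1) are nested prefixes of length ≥ 2^m, so every gap of the
-- fixed point is already visible in a finite σ^m(1).

zeros-+ : ∀ a b → zeros (a + b) ≡ zeros a ++ zeros b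
zeros-+ zero    b = refl
zeros-+ (suc a) b = cong (false ∷_) (zeros-+ a b)

at-++ˡ : ∀ (u v : List Bool) {i} → i < length u → at (u ++ v) i ≡ at u i
at-++ˡ (x ∷ u) v {zero}  _         = refl
at-++ˡ (x ∷ u) v {suc i} (s≤s i<u) = at-++ˡ u v i<u

at-zeros-< : ∀ g (v : List Bool) {i} → i < g → at (zeros g ++ v) i ≡ false
at-zeros-< (suc g) v {zero}  _         = refl
at-zeros-< (suc g) v {suc i} (s≤s i<g) = at-zeros-< g v i<g

at-zeros-+ : ∀ g (v : List Bool) i → at (zeros g ++ v) (g + i) ≡ at v i
at-zeros-+ zero    v i = refl
at-zeros-+ (suc g) v i = at-zeros-+ g v i

countOnes-cong : ∀ (w w′ : ℕ → Bool) p → (∀ i → i < p → w i ≡ w′ i) →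
                 countOnes w p ≡ countOnes w′ p
countOnes-cong w w′ zero    w≗w′ = refl
countOnes-cong w w′ (suc p) w≗w′ with w p | w′ p | w≗w′ p ≤-refl
... | true  | true  | refl = cong suc (countOnes-cong w w′ p (λ i i<p → w≗w′ i (m<n⇒m<1+n i<p)))
... | false | false | refl = countOnes-cong w w′ p (λ i i<p → w≗w′ i (m<n⇒m<1+n i<p))

countOnes-suc : ∀ w p → countOnes w (suc p) ≡ countOnes w 1 + countOnes (w ∘ suc) p
countOnes-suc w zero = sym (+-identityʳ _)
countOnes-suc w (suc p) with w (suc p)
... | true  = trans (cong suc (countOnes-suc w p)) (sym (+-suc _ _))
... | false = countOnes-suc w p

countOnes-zeros-+ : ∀ g (v : List Bool) p → countOnes (at (zeros g ++ v)) (g + p) ≡ countOnes (at v) p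
countOnes-zeros-+ zero    v p = refl
countOnes-zeros-+ (suc g) v p = trans (countOnes-suc (at (zeros (suc g) ++ v)) (g + p)) (countOnes-zeros-+ g v p)

-- A gap list g₀ g₁ … is encoded as 1 0^{g₀} 1 0^{g₁} …; the last gap is not
-- closed by a 1, so only the gaps before the last one are gaps of the word.
encode : List ℕ → List Bool
encode []       = []
encode (g ∷ gs) = true ∷ zeros g ++ encode gs

gapAt : List ℕ → ℕ → ℕ
gapAt []       _       = 0
gapAt (g ∷ gs) zero    = g
gapAt (g ∷ gs) (suc t) = gapAt gs t

onePosition : List ℕ → ℕ → ℕ
onePosition []       _       = 0
onePosition (g ∷ gs) zero    = 0
onePosition (g ∷ gs) (suc t) = suc (g + onePosition gs t)

length-zeros-++-encode : ∀ g gs → length (zeros g ++ encode gs) ≡ g + length (encode gs)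
length-zeros-++-encode g gs = trans (length-++ (zeros g)) (cong (_+ length (encode gs)) (length-replicate g))

length≤length-encode : ∀ G → length G ≤ length (encode G)
length≤length-encode []       = z≤n
length≤length-encode (g ∷ gs) rewrite length-zeros-++-encode g gs =
  s≤s (≤-trans (length≤length-encode gs) (m≤n+m _ g))

onePosition<length-encode : ∀ G {t} → t < length G → onePosition G t < length (encode G)
onePosition<length-encode (g ∷ gs) {zero}  _         = s≤s z≤n
onePosition<length-encode (g ∷ gs) {suc t} (s≤s t<G) rewrite length-zeros-++-encode g gs =
  s≤s (+-monoʳ-< g (onePosition<length-encode gs t<G))

at-encode-onePosition : ∀ G {t} → t < length G → at (encode G) (onePosition G t) ≡ true
at-encode-onePosition (g ∷ gs) {zero}  _         = refl
at-encode-onePosition (g ∷ gs) {suc t} (s≤s t<G) =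
  trans (at-zeros-+ g (encode gs) (onePosition gs t)) (at-encode-onePosition gs t<G)

at-encode-gap : ∀ G {t i} → t < length G → i < gapAt G t →
                at (encode G) (onePosition G t + suc i) ≡ false
at-encode-gap (g ∷ gs) {zero}      _         i<g = at-zeros-< g (encode gs) i<g
at-encode-gap (g ∷ gs) {suc t} {i} (s≤s t<G) i<g rewrite +-assoc g (onePosition gs t) (suc i) =
  trans (at-zeros-+ g (encode gs) (onePosition gs t + suc i)) (at-encode-gap gs t<G i<g)

onePosition-suc : ∀ G {t} → suc t < length G → onePosition G t + suc (gapAt G t) ≡ onePosition G (suc t)
onePosition-suc (g ∷ h ∷ hs) {zero}  _         = cong suc (sym (+-identityʳ g))
onePosition-suc (g ∷ gs)     {suc t} (s≤s t<G) =
  cong suc (trans (+-assoc g _ _) (cong (g +_) (onePosition-suc gs t<G)))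

countOnes-encode-onePosition : ∀ G {t} → t < length G → countOnes (at (encode G)) (onePosition G t) ≡ t
countOnes-encode-onePosition (g ∷ gs) {zero}  _         = refl
countOnes-encode-onePosition (g ∷ gs) {suc t} (s≤s t<G) =
  trans (countOnes-suc (at (encode (g ∷ gs))) (g + onePosition gs t))
        (cong suc (trans (countOnes-zeros-+ g (encode gs) (onePosition gs t))
                         (countOnes-encode-onePosition gs t<G)))

IsMu-encode : ∀ (w : ℕ → Bool) G {t} → (∀ i → i < length (encode G) → w i ≡ at (encode G) i) →
              suc t < length G → IsMu w (suc t) (gapAt G t)
IsMu-encode w G {t} w≗encode t+1<G =
  p , one-at-p , cong suc count-before-p , one-at-q , zeros-between
  where
  t<G : t < length G
  t<G = <⇒≤ t+1<G
  p q : ℕ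
  p = onePosition G t
  q = onePosition G (suc t)
  q<E : q < length (encode G)
  q<E = onePosition<length-encode G t+1<G
  p<E : p < length (encode G)
  p<E = onePosition<length-encode G t<G
  one-at-p : w p ≡ true
  one-at-p = trans (w≗encode p p<E) (at-encode-onePosition G t<G)
  count-before-p : countOnes w p ≡ t
  count-before-p = trans (countOnes-cong _ _ p (λ i i<p → w≗encode i (<-trans i<p p<E)))
                         (countOnes-encode-onePosition G t<G)
  one-at-q : w (p + suc (gapAt G t)) ≡ true
  one-at-q rewrite onePosition-suc G t+1<G = trans (w≗encode q q<E) (at-encode-onePosition G t+1<G)
  zeros-between : ∀ i → i < gapAt G t → w (p + suc i) ≡ false
  zeros-between i i<g = trans (w≗encode _ (<-≤-trans p+i+1<q (<⇒≤ q<E))) (at-encode-gap G t<G i<g)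
    where
    p+i+1<q : p + suc i < q
    p+i+1<q = subst (p + suc i <_) (onePosition-suc G t+1<G) (+-monoʳ-< p (s≤s i<g))

n<2^n : ∀ n → n < 2 ^ n
n<2^n zero    = s≤s z≤n
n<2^n (suc n) = subst (suc n <_) (cong (2 ^ n +_) (sym (+-identityʳ (2 ^ n))))
                      (+-mono-≤ (m^n>0 2 n) (n<2^n n))

suc≡2*-inv : ∀ n {t} → suc t ≡ 2 * n → Σ ℕ λ s → n ≡ suc s × t ≡ suc (2 * s)
suc≡2*-inv (suc s) eq = s , refl , trans (suc-injective eq) (+-suc s (s + 0))

2^0*odd : ∀ j → 2 ^ 0 * (2 * j + 1) ≡ suc (2 * j)
2^0*odd = solve-∀

module _ (l1 l2 l3 : ℕ) where

  σ-gaps : List ℕ → List ℕ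
  σ-gaps []       = []
  σ-gaps (g ∷ gs) = l1 ∷ l2 + l3 * g ∷ σ-gaps gs

  gaps : ℕ → List ℕ
  gaps zero    = 0 ∷ []
  gaps (suc m) = σ-gaps (gaps m)

  σ*-zeros : ∀ g → σ* l1 l2 l3 (zeros g) ≡ zeros (l3 * g)
  σ*-zeros zero    rewrite *-zeroʳ l3 = refl
  σ*-zeros (suc g) rewrite *-suc l3 g | zeros-+ l3 (l3 * g) = cong (zeros l3 ++_) (σ*-zeros g)

  σ*-encode : ∀ G → σ* l1 l2 l3 (encode G) ≡ encode (σ-gaps G)
  σ*-encode []       = refl
  σ*-encode (g ∷ gs) = cong (true ∷_) (begin
      (zeros l1 ++ true ∷ zeros l2) ++ σ* l1 l2 l3 (zeros g ++ encode gs)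
        ≡⟨ cong ((zeros l1 ++ true ∷ zeros l2) ++_)
             (trans (concatMap-++ (σ l1 l2 l3) (zeros g) (encode gs))
                    (cong₂ _++_ (σ*-zeros g) (σ*-encode gs))) ⟩
      (zeros l1 ++ true ∷ zeros l2) ++ zeros (l3 * g) ++ encode (σ-gaps gs)
        ≡⟨ ++-assoc (zeros l1) (true ∷ zeros l2) _ ⟩
      zeros l1 ++ true ∷ zeros l2 ++ zeros (l3 * g) ++ encode (σ-gaps gs)
        ≡⟨ cong (λ z → zeros l1 ++ true ∷ z) (sym (++-assoc (zeros l2) (zeros (l3 * g)) _)) ⟩
      zeros l1 ++ true ∷ (zeros l2 ++ zeros (l3 * g)) ++ encode (σ-gaps gs)
        ≡⟨ cong (λ z → zeros l1 ++ true ∷ z ++ encode (σ-gaps gs)) (sym (zeros-+ l2 (l3 * g))) ⟩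
      zeros l1 ++ true ∷ zeros (l2 + l3 * g) ++ encode (σ-gaps gs) ∎)
    where open ≡-Reasoning

  σ^-encode : ∀ m → σ^ l1 l2 l3 m ≡ encode (gaps m)
  σ^-encode zero    = refl
  σ^-encode (suc m) = trans (cong (σ* l1 l2 l3) (σ^-encode m)) (σ*-encode (gaps m))

  length-σ-gaps : ∀ G → length (σ-gaps G) ≡ 2 * length G
  length-σ-gaps []       = refl
  length-σ-gaps (g ∷ gs) = trans (cong (2 +_) (length-σ-gaps gs)) (sym (*-suc 2 (length gs)))

  length-gaps : ∀ m → length (gaps m) ≡ 2 ^ m
  length-gaps zero    = refl
  length-gaps (suc m) = trans (length-σ-gaps (gaps m)) (cong (2 *_) (length-gaps m))

  gapAt-σ-gaps-even : ∀ G {s} → s < length G → gapAt (σ-gaps G) (2 * s) ≡ l1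
  gapAt-σ-gaps-even (g ∷ gs) {zero}  _         = refl
  gapAt-σ-gaps-even (g ∷ gs) {suc s} (s≤s s<G) rewrite +-suc s (s + 0) = gapAt-σ-gaps-even gs s<G

  gapAt-σ-gaps-odd : ∀ G {s} → s < length G → gapAt (σ-gaps G) (suc (2 * s)) ≡ l2 + l3 * gapAt G s
  gapAt-σ-gaps-odd (g ∷ gs) {zero}  _         = refl
  gapAt-σ-gaps-odd (g ∷ gs) {suc s} (s≤s s<G) rewrite +-suc s (s + 0) = gapAt-σ-gaps-odd gs s<G

  μ : ℕ → ℕ
  μ zero    = l1
  μ (suc k) = l2 + l3 * μ k

  gapAt-gaps : ∀ k j m {t} → suc t ≡ 2 ^ k * (2 * j + 1) → suc t < 2 ^ m → gapAt (gaps m) t ≡ μ k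
  gapAt-gaps k       j zero    _  (s≤s ())
  gapAt-gaps zero    j (suc m) eq t+1<2^m with suc-injective (trans eq (2^0*odd j))
  ... | refl = gapAt-σ-gaps-even (gaps m) (subst (j <_) (sym (length-gaps m)) j<2^m)
    where
    j<2^m : j < 2 ^ m
    j<2^m = *-cancelˡ-< 2 j (2 ^ m) (<-trans (n<1+n _) t+1<2^m)
  gapAt-gaps (suc k) j (suc m) eq t+1<2^m
    with suc≡2*-inv (2 ^ k * (2 * j + 1)) (trans eq (*-assoc 2 (2 ^ k) _))
  ... | s , n≡s+1 , refl =
    trans (gapAt-σ-gaps-odd (gaps m) (subst (s <_) (sym (length-gaps m)) (<⇒≤ s+1<2^m)))
          (cong (λ g → l2 + l3 * g) (gapAt-gaps k j m (sym n≡s+1) s+1<2^m))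
    where
    s+1<2^m : suc s < 2 ^ m
    s+1<2^m = *-cancelˡ-< 2 (suc s) (2 ^ m) (subst (_< 2 ^ suc m) (sym (*-suc 2 s)) t+1<2^m)

  σ^-prefix-suc : ∀ m → Σ (List Bool) λ r → σ^ l1 l2 l3 (suc m) ≡ σ^ l1 l2 l3 m ++ r
  σ^-prefix-suc zero    = _ , refl
  σ^-prefix-suc (suc m) with σ^-prefix-suc m
  ... | r , eq = σ* l1 l2 l3 r , trans (cong (σ* l1 l2 l3) eq) (concatMap-++ (σ l1 l2 l3) (σ^ l1 l2 l3 m) r)

  σ^-prefix : ∀ {a b} → a ≤′ b → Σ (List Bool) λ r → σ^ l1 l2 l3 b ≡ σ^ l1 l2 l3 a ++ r
  σ^-prefix ≤′-refl = [] , sym (++-identityʳ _)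
  σ^-prefix {a} (≤′-step {b} a≤b) with σ^-prefix a≤b | σ^-prefix-suc b
  ... | r , eq | r′ , eq′ =
    r ++ r′ , trans eq′ (trans (cong (_++ r′) eq) (++-assoc (σ^ l1 l2 l3 a) r r′))

  at-σ^-mono : ∀ {a b i} → a ≤ b → i < length (σ^ l1 l2 l3 a) →
               at (σ^ l1 l2 l3 b) i ≡ at (σ^ l1 l2 l3 a) i
  at-σ^-mono {a} {i = i} a≤b i<σ^a with σ^-prefix (≤⇒≤′ a≤b)
  ... | r , eq = trans (cong (λ w → at w i) eq) (at-++ˡ (σ^ l1 l2 l3 a) r i<σ^a)

  2^m≤length-σ^ : ∀ m → 2 ^ m ≤ length (σ^ l1 l2 l3 m)
  2^m≤length-σ^ m rewrite σ^-encode m =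
    subst (_≤ length (encode (gaps m))) (length-gaps m) (length≤length-encode (gaps m))

  fixpt-σ^ : ∀ m i → i < length (σ^ l1 l2 l3 m) → fixpt l1 l2 l3 i ≡ at (σ^ l1 l2 l3 m) i
  fixpt-σ^ m i i<σ^m with ≤-total (suc i) m
  ... | inj₁ i<m =
    sym (at-σ^-mono i<m (<-≤-trans (<-trans (n<1+n i) (n<2^n (suc i))) (2^m≤length-σ^ (suc i))))
  ... | inj₂ m≤i = at-σ^-mono m≤i i<σ^m

  IsMu-fixpt : ∀ t → IsMu (fixpt l1 l2 l3) (suc t) (gapAt (gaps (suc t)) t)
  IsMu-fixpt t = IsMu-encode (fixpt l1 l2 l3) (gaps (suc t)) fixpt≗encode t+1<gaps
    where
    fixpt≗encode : ∀ i → i < length (encode (gaps (suc t))) →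
                   fixpt l1 l2 l3 i ≡ at (encode (gaps (suc t))) i
    fixpt≗encode i rewrite sym (σ^-encode (suc t)) = fixpt-σ^ (suc t) i
    t+1<gaps : suc t < length (gaps (suc t))
    t+1<gaps = subst (suc t <_) (sym (length-gaps (suc t))) (n<2^n (suc t))

geometric : ℕ → ℕ → ℕ
geometric r zero    = 0
geometric r (suc k) = 1 + r * geometric r k

1+d^k≡1+geometric*d : ∀ d k → suc d ^ k ≡ suc (geometric (suc d) k * d)
1+d^k≡1+geometric*d d zero    = refl
1+d^k≡1+geometric*d d (suc k) rewrite 1+d^k≡1+geometric*d d k = step d (geometric (suc d) k)
  where
  step : ∀ d g → suc d * suc (g * d) ≡ suc ((1 + suc d * g) * d)
  step = solve-∀

μ-closed : ∀ l1 l2 l3 k → μ l1 l2 l3 k ≡ l2 * geometric l3 k + l1 * l3 ^ k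
μ-closed l1 l2 l3 zero    rewrite *-zeroʳ l2 | *-identityʳ l1 = refl
μ-closed l1 l2 l3 (suc k) rewrite μ-closed l1 l2 l3 k = step l1 l2 l3 (geometric l3 k) (l3 ^ k)
  where
  step : ∀ l1 l2 l3 g p → l2 + l3 * (l2 * g + l1 * p) ≡ l2 * (1 + l3 * g) + l1 * (l3 * p)
  step = solve-∀

μ≡muFormula : ∀ l1 l2 l3 (h : 3 ≤ l3) k → μ l1 l2 l3 k ≡ muFormula l1 l2 l3 h k
μ≡muFormula l1 l2 l3 h@(s≤s (s≤s (s≤s _))) k =
  trans (μ-closed l1 l2 l3 k) (cong (_+ l1 * l3 ^ k) (sym quotient))
  where
  open ≡-Reasoning
  d = l3 ∸ 1
  quotient : l2 * (l3 ^ k ∸ 1) / d ≡ l2 * geometric l3 k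
  quotient = begin
    l2 * (l3 ^ k ∸ 1) / d         ≡⟨ cong (λ x → l2 * (x ∸ 1) / d) (1+d^k≡1+geometric*d d k) ⟩
    l2 * (geometric l3 k * d) / d ≡⟨ cong (_/ d) (sym (*-assoc l2 (geometric l3 k) d)) ⟩
    l2 * geometric l3 k * d / d   ≡⟨ m*n/n≡m (l2 * geometric l3 k) d ⟩
    l2 * geometric l3 k           ∎

mainTheorem6 : (l1 l2 l3 : ℕ) → (h : 3 ≤ l3) →
    (n k j : ℕ) → n ≡ 2 ^ k * (2 * j + 1) →
    IsMu (fixpt l1 l2 l3) n (muFormula l1 l2 l3 h k)
mainTheorem6 l1 l2 l3 h zero    k j eq = ⊥-elim (<⇒≢ (*-mono-≤ (m^n>0 2 k) (m≤n+m 1 (2 * j))) eq)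
mainTheorem6 l1 l2 l3 h (suc t) k j eq =
  subst (IsMu (fixpt l1 l2 l3) (suc t))
        (trans (gapAt-gaps l1 l2 l3 k j (suc t) eq (n<2^n (suc t))) (μ≡muFormula l1 l2 l3 h k))
        (IsMu-fixpt l1 l2 l3 t)
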